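{- Let a group $G$ act (not necessarily faithfully) on a finite set $X$, and for $Y\subseteq X$ let $F(Y)$ denote the pointwise stabilizer of $Y$ in $G$. Let $Y_1,Y_2\subseteq X$ with $|Y_1|=|Y_2|<|X|/2$ and suppose that $F(Y_i)$ acts transitively on $X\setminus Y_i$ for $i=1,2$. Then there is $g\in G$ with $Y_2^g=Y_1$. In particular, $F(Y_1)$ and $F(Y_2)$ are conjugate in $G$. -}

module Defs where

open import Level using (Level; _⊔_)
open import Algebra.Bundles using (Group)
open import Data.Nat using (ℕ)
open import Data.Fin using (Fin)
open import Data.Fin.Subset using (Subset; _∈_; _∉_)
open import Data.Product using (Σ; ∃; _×_; _,_)
open import Relation.Binary.PropositionalEquality using (_≡_)

record RightAction {c ℓ : Level} (G : Group c ℓ) (n : ℕ) : Set (c ⊔ ℓ) where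
  open Group G
  field
    _^_      : Fin n → Carrier → Fin n
    ^-ε      : ∀ x → x ^ ε ≡ x
    ^-∙      : ∀ x g h → x ^ (g ∙ h) ≡ (x ^ g) ^ h
    ^-resp-≈ : ∀ x {g h} → g ≈ h → x ^ g ≡ x ^ h

module _ {c ℓ : Level} {G : Group c ℓ} {n : ℕ} (A : RightAction G n) where
  open Group G
  open RightAction A

  InStab : Subset n → Carrier → Set
  InStab Y h = ∀ x → x ∈ Y → x ^ h ≡ x

  StabTransitiveOnCompl : Subset n → Set c
  StabTransitiveOnCompl Y =
    ∀ x y → x ∉ Y → y ∉ Y → Σ Carrier (λ h → InStab Y h × x ^ h ≡ y)

  ImageEq : Subset n → Carrier → Subset n → Set
  ImageEq Y g Z =
    (∀ y → y ∈ Y → (y ^ g) ∈ Z) × (∀ z → z ∈ Z → Σ (Fin n) (λ y → y ∈ Y × y ^ g ≡ z))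

-- Write Z_g for the preimage of Y₁ under g, i.e. Y₁^(g⁻¹); all Z_g have |Y₁| points and,
-- by conjugation, a pointwise stabilizer transitive on their complement. If Y₂ ⊈ Z_g, pick
-- b ∈ Y₂ ∖ Z_g; as |Z_g| = |Y₂| there is a ∈ Z_g ∖ Y₂, and as |Z_g ∪ Y₂| < |X| there is c
-- outside both. Some k ∈ F(Z_g) sends b to c and some f ∈ F(Y₂) sends c to a; then k f fixes
-- Y₂ ∩ Z_g pointwise and sends b into Z_g, so Z_{kfg} meets Y₂ in strictly more points than
-- Z_g. Iterating ends with Y₂ ⊆ Z_g, hence Y₂ = Z_g = Y₁^(g⁻¹), and conjugation by g carries
-- F(Y₂) onto F(Y₁).
module Submission where

open import Level using (Level)
open import Algebra.Bundles using (Group)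
open import Data.Bool using (true; false)
open import Data.Nat using (ℕ; _+_; _*_; _≤_; _<_; z≤n; s≤s)
import Data.Nat.Properties as ℕₚ
open import Data.Fin as Fin using (Fin)
open import Data.Fin.Permutation using (Permutation; permutation; _⟨$⟩ʳ_)
open import Data.Fin.Subset using (Subset; Side; ∣_∣; _∈_; _∉_; _⊆_; _⊂_; _⊃_; _∩_; _∪_; ∁; ⊤)
open import Data.Fin.Subset.Properties
  using (nonempty?; x∈p∩q⁺; x∈p∩q⁻; x∈p∪q⁺; x∈∁p⇒x∉p; x∉∁p⇒x∈p; p⊆q⇒∣p∣≤∣q∣; p⊂q⇒∣p∣<∣q∣; ∣⊤∣≡n)
open import Data.Fin.Subset.Induction using (⊃-wellFounded; Acc; acc)
open import Data.Vec using (_∷_; []; tabulate; lookup)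
open import Data.Vec.Properties using (lookup∘tabulate; tabulate∘lookup; tabulate-cong; []=⇒lookup; lookup⇒[]=)
open import Data.Product using (Σ; ∃; _×_; _,_; proj₂)
open import Data.Sum using (_⊎_; inj₁; inj₂)
open import Function using (_∘_)
open import Function.Bundles using (_⇔_; mk⇔)
open import Relation.Nullary using (yes; no)
open import Relation.Nullary.Negation using (contradiction)
open import Relation.Binary.PropositionalEquality
  using (_≡_; refl; sym; trans; cong; subst; module ≡-Reasoning)
open import Algebra.Properties.CommutativeMonoid.Sum ℕₚ.+-0-commutativeMonoid
  using (sum; sum-permute)
open import Defs

module _ {n : ℕ} where

  ⊆-or-∃∉ : ∀ (p q : Subset n) → p ⊆ q ⊎ ∃ λ x → x ∈ p × x ∉ q
  ⊆-or-∃∉ p q with nonempty? (p ∩ ∁ q)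
  ... | yes (x , x∈p∩∁q) = let x∈p , x∈∁q = x∈p∩q⁻ p (∁ q) x∈p∩∁q in inj₂ (x , x∈p , x∈∁p⇒x∉p x∈∁q)
  ... | no empty = inj₁ λ {x} x∈p → x∉∁p⇒x∈p (λ x∈∁q → empty (x , x∈p∩q⁺ (x∈p , x∈∁q)))

  p⊆q∧∣q∣≤∣p∣⇒q⊆p : ∀ {p q : Subset n} → p ⊆ q → ∣ q ∣ ≤ ∣ p ∣ → q ⊆ p
  p⊆q∧∣q∣≤∣p∣⇒q⊆p {p} {q} p⊆q ∣q∣≤∣p∣ with ⊆-or-∃∉ q p
  ... | inj₁ q⊆p = q⊆p
  ... | inj₂ (x , x∈q , x∉p) = contradiction (p⊂q⇒∣p∣<∣q∣ (p⊆q , x , x∈q , x∉p)) (ℕₚ.≤⇒≯ ∣q∣≤∣p∣)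

  ∣p∣<n⇒∃∉ : ∀ (p : Subset n) → ∣ p ∣ < n → ∃ λ x → x ∉ p
  ∣p∣<n⇒∃∉ p ∣p∣<n with ⊆-or-∃∉ ⊤ p
  ... | inj₁ ⊤⊆p = contradiction (subst (_≤ ∣ p ∣) (∣⊤∣≡n n) (p⊆q⇒∣p∣≤∣q∣ ⊤⊆p)) (ℕₚ.<⇒≱ ∣p∣<n)
  ... | inj₂ (x , _ , x∉p) = x , x∉p

  ∃∈p∖q⇒∃∈q∖p : ∀ {p q : Subset n} {x} → ∣ p ∣ ≤ ∣ q ∣ → x ∈ p → x ∉ q → ∃ λ y → y ∈ q × y ∉ p
  ∃∈p∖q⇒∃∈q∖p {p} {q} ∣p∣≤∣q∣ x∈p x∉q with ⊆-or-∃∉ q p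
  ... | inj₁ q⊆p = contradiction (p⊆q∧∣q∣≤∣p∣⇒q⊆p q⊆p ∣p∣≤∣q∣ x∈p) x∉q
  ... | inj₂ y∈q∖p = y∈q∖p

∣p∪q∣≤∣p∣+∣q∣ : ∀ {n} (p q : Subset n) → ∣ p ∪ q ∣ ≤ ∣ p ∣ + ∣ q ∣
∣p∪q∣≤∣p∣+∣q∣ [] [] = z≤n
∣p∪q∣≤∣p∣+∣q∣ (true ∷ p) (true ∷ q) = s≤s (ℕₚ.≤-trans (∣p∪q∣≤∣p∣+∣q∣ p q) (ℕₚ.+-monoʳ-≤ ∣ p ∣ (ℕₚ.n≤1+n _)))
∣p∪q∣≤∣p∣+∣q∣ (true ∷ p) (false ∷ q) = s≤s (∣p∪q∣≤∣p∣+∣q∣ p q)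
∣p∪q∣≤∣p∣+∣q∣ (false ∷ p) (true ∷ q) = ℕₚ.≤-trans (s≤s (∣p∪q∣≤∣p∣+∣q∣ p q)) (ℕₚ.≤-reflexive (sym (ℕₚ.+-suc ∣ p ∣ ∣ q ∣)))
∣p∪q∣≤∣p∣+∣q∣ (false ∷ p) (false ∷ q) = ∣p∪q∣≤∣p∣+∣q∣ p q

indicator : Side → ℕ
indicator true = 1
indicator false = 0

∣tabulate∣≡sum : ∀ {n} (f : Fin n → Side) → ∣ tabulate f ∣ ≡ sum (indicator ∘ f)
∣tabulate∣≡sum {ℕ.zero} f = refl
∣tabulate∣≡sum {ℕ.suc n} f with f Fin.zero
... | true = cong ℕ.suc (∣tabulate∣≡sum (f ∘ Fin.suc))
... | false = ∣tabulate∣≡sum (f ∘ Fin.suc)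

∣tabulate∘permute∣ : ∀ {n} (p : Subset n) (π : Permutation n n) →
                     ∣ tabulate (lookup p ∘ (π ⟨$⟩ʳ_)) ∣ ≡ ∣ p ∣
∣tabulate∘permute∣ p π = begin
  ∣ tabulate (lookup p ∘ (π ⟨$⟩ʳ_)) ∣  ≡⟨ ∣tabulate∣≡sum (lookup p ∘ (π ⟨$⟩ʳ_)) ⟩
  sum (indicator ∘ lookup p ∘ (π ⟨$⟩ʳ_)) ≡⟨ sum-permute (indicator ∘ lookup p) π ⟨
  sum (indicator ∘ lookup p)            ≡⟨ ∣tabulate∣≡sum (lookup p) ⟨
  ∣ tabulate (lookup p) ∣               ≡⟨ cong ∣_∣ (tabulate∘lookup p) ⟩
  ∣ p ∣                                 ∎
  where open ≡-Reasoning

module _ {c ℓ : Level} {G : Group c ℓ} {n : ℕ} (A : RightAction G n) where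
  open Group G using (Carrier; ε; _∙_; _⁻¹; inverseˡ; inverseʳ)
  open RightAction A

  ^-inverseʳ : ∀ x g → (x ^ g) ^ (g ⁻¹) ≡ x
  ^-inverseʳ x g = trans (sym (^-∙ x g (g ⁻¹))) (trans (^-resp-≈ x (inverseʳ g)) (^-ε x))

  ^-inverseˡ : ∀ x g → (x ^ (g ⁻¹)) ^ g ≡ x
  ^-inverseˡ x g = trans (sym (^-∙ x (g ⁻¹) g)) (trans (^-resp-≈ x (inverseˡ g)) (^-ε x))

  ^-∙∙ : ∀ x f g h → x ^ (f ∙ g ∙ h) ≡ ((x ^ f) ^ g) ^ h
  ^-∙∙ x f g h = trans (^-∙ x (f ∙ g) h) (cong (_^ h) (^-∙ x f g))

  preimage : Subset n → Carrier → Subset n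
  preimage Y g = tabulate (λ x → lookup Y (x ^ g))

  ∈-preimage⁺ : ∀ {Y g x} → x ^ g ∈ Y → x ∈ preimage Y g
  ∈-preimage⁺ {Y} {g} {x} x^g∈Y =
    lookup⇒[]= x (preimage Y g) (trans (lookup∘tabulate _ x) ([]=⇒lookup x^g∈Y))

  ∈-preimage⁻ : ∀ {Y g x} → x ∈ preimage Y g → x ^ g ∈ Y
  ∈-preimage⁻ {Y} {g} {x} x∈Z =
    lookup⇒[]= (x ^ g) Y (trans (sym (lookup∘tabulate _ x)) ([]=⇒lookup x∈Z))

  preimage-∙ : ∀ Y g h → preimage Y (g ∙ h) ≡ preimage (preimage Y h) g
  preimage-∙ Y g h = tabulate-cong λ x → begin
    lookup Y (x ^ (g ∙ h))                            ≡⟨ cong (lookup Y) (^-∙ x g h) ⟩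
    lookup Y ((x ^ g) ^ h)                            ≡⟨ lookup∘tabulate (λ y → lookup Y (y ^ h)) (x ^ g) ⟨
    lookup (tabulate (λ y → lookup Y (y ^ h))) (x ^ g) ∎
    where open ≡-Reasoning

  ∣preimage∣ : ∀ Y g → ∣ preimage Y g ∣ ≡ ∣ Y ∣
  ∣preimage∣ Y g = ∣tabulate∘permute∣ Y
    (permutation (_^ g) (_^ (g ⁻¹)) (λ x → ^-inverseˡ x g) (λ x → ^-inverseʳ x g))

  StabTransitiveOnCompl-preimage : ∀ {Y} g → StabTransitiveOnCompl A Y →
                                   StabTransitiveOnCompl A (preimage Y g)
  StabTransitiveOnCompl-preimage {Y} g transitive x y x∉Z y∉Z
    with transitive (x ^ g) (y ^ g) (x∉Z ∘ ∈-preimage⁺) (y∉Z ∘ ∈-preimage⁺)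
  ... | h , h∈F[Y] , x^g^h≡y^g = g ∙ h ∙ g ⁻¹ , conj∈F[Z] , conj-x≡y
    where
    open ≡-Reasoning
    conj∈F[Z] : InStab A (preimage Y g) (g ∙ h ∙ g ⁻¹)
    conj∈F[Z] z z∈Z = begin
      z ^ (g ∙ h ∙ g ⁻¹)           ≡⟨ ^-∙∙ z g h (g ⁻¹) ⟩
      ((z ^ g) ^ h) ^ (g ⁻¹)       ≡⟨ cong (_^ (g ⁻¹)) (h∈F[Y] (z ^ g) (∈-preimage⁻ z∈Z)) ⟩
      (z ^ g) ^ (g ⁻¹)             ≡⟨ ^-inverseʳ z g ⟩
      z                            ∎
    conj-x≡y : x ^ (g ∙ h ∙ g ⁻¹) ≡ y
    conj-x≡y = begin
      x ^ (g ∙ h ∙ g ⁻¹)           ≡⟨ ^-∙∙ x g h (g ⁻¹) ⟩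
      ((x ^ g) ^ h) ^ (g ⁻¹)       ≡⟨ cong (_^ (g ⁻¹)) x^g^h≡y^g ⟩
      (y ^ g) ^ (g ⁻¹)             ≡⟨ ^-inverseʳ y g ⟩
      y                            ∎

  ImageEq-preimage : ∀ {Y g Z} → Y ⊆ preimage Z g → preimage Z g ⊆ Y → ImageEq A Y g Z
  ImageEq-preimage {Y} {g} {Z} Y⊆Z' Z'⊆Y =
    (λ y y∈Y → ∈-preimage⁻ (Y⊆Z' y∈Y)) ,
    (λ z z∈Z → z ^ (g ⁻¹) , Z'⊆Y (∈-preimage⁺ (subst (_∈ Z) (sym (^-inverseˡ z g)) z∈Z)) , ^-inverseˡ z g)

  InStab-conj : ∀ {Y g Z} → ImageEq A Y g Z → ∀ h → InStab A Y h ⇔ InStab A Z (g ⁻¹ ∙ h ∙ g)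
  InStab-conj {Y} {g} {Z} (Y^g⊆Z , Z⊆Y^g) h = mk⇔ to from
    where
    open ≡-Reasoning
    to : InStab A Y h → InStab A Z (g ⁻¹ ∙ h ∙ g)
    to h∈F[Y] z z∈Z with Z⊆Y^g z z∈Z
    ... | y , y∈Y , refl = begin
      (y ^ g) ^ (g ⁻¹ ∙ h ∙ g)      ≡⟨ ^-∙∙ (y ^ g) (g ⁻¹) h g ⟩
      ((((y ^ g) ^ (g ⁻¹)) ^ h) ^ g) ≡⟨ cong (λ t → (t ^ h) ^ g) (^-inverseʳ y g) ⟩
      (y ^ h) ^ g                   ≡⟨ cong (_^ g) (h∈F[Y] y y∈Y) ⟩
      y ^ g                         ∎
    from : InStab A Z (g ⁻¹ ∙ h ∙ g) → InStab A Y h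
    from conj∈F[Z] y y∈Y = begin
      y ^ h                         ≡⟨ ^-inverseʳ (y ^ h) g ⟨
      ((y ^ h) ^ g) ^ (g ⁻¹)        ≡⟨ cong (λ t → ((t ^ h) ^ g) ^ (g ⁻¹)) (^-inverseʳ y g) ⟨
      ((((y ^ g) ^ (g ⁻¹)) ^ h) ^ g) ^ (g ⁻¹) ≡⟨ cong (_^ (g ⁻¹)) (^-∙∙ (y ^ g) (g ⁻¹) h g) ⟨
      ((y ^ g) ^ (g ⁻¹ ∙ h ∙ g)) ^ (g ⁻¹)     ≡⟨ cong (_^ (g ⁻¹)) (conj∈F[Z] (y ^ g) (Y^g⊆Z y y∈Y)) ⟩
      (y ^ g) ^ (g ⁻¹)              ≡⟨ ^-inverseʳ y g ⟩
      y                             ∎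

  exchange : ∀ {Y Z} → StabTransitiveOnCompl A Y → StabTransitiveOnCompl A Z →
             ∣ Y ∣ ≤ ∣ Z ∣ → ∣ Z ∣ + ∣ Y ∣ < n → ∀ {b} → b ∈ Y → b ∉ Z →
             Σ Carrier λ u → Y ∩ Z ⊂ Y ∩ preimage Z u
  exchange {Y} {Z} transitiveY transitiveZ ∣Y∣≤∣Z∣ ∣Z∣+∣Y∣<n {b} b∈Y b∉Z
    with ∃∈p∖q⇒∃∈q∖p ∣Y∣≤∣Z∣ b∈Y b∉Z
       | ∣p∣<n⇒∃∉ (Z ∪ Y) (ℕₚ.≤-<-trans (∣p∪q∣≤∣p∣+∣q∣ Z Y) ∣Z∣+∣Y∣<n)
  ... | a , a∈Z , a∉Y | c , c∉Z∪Y
    with transitiveZ b c b∉Z (c∉Z∪Y ∘ x∈p∪q⁺ ∘ inj₁) | transitiveY c a (c∉Z∪Y ∘ x∈p∪q⁺ ∘ inj₂) a∉Y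
  ... | k , k∈F[Z] , b^k≡c | f , f∈F[Y] , c^f≡a =
    k ∙ f , Y∩Z⊆Y∩Z′ , b , x∈p∩q⁺ (b∈Y , ∈-preimage⁺ (subst (_∈ Z) (sym b^kf≡a) a∈Z)) , b∉Z ∘ proj₂ ∘ x∈p∩q⁻ Y Z
    where
    open ≡-Reasoning
    Y∩Z⊆Y∩Z′ : Y ∩ Z ⊆ Y ∩ preimage Z (k ∙ f)
    Y∩Z⊆Y∩Z′ {x} x∈Y∩Z with x∈p∩q⁻ Y Z x∈Y∩Z
    ... | x∈Y , x∈Z = x∈p∩q⁺ (x∈Y , ∈-preimage⁺ (subst (_∈ Z) (sym x^kf≡x) x∈Z))
      where
      x^kf≡x : x ^ (k ∙ f) ≡ x
      x^kf≡x = begin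
        x ^ (k ∙ f)   ≡⟨ ^-∙ x k f ⟩
        (x ^ k) ^ f   ≡⟨ cong (_^ f) (k∈F[Z] x x∈Z) ⟩
        x ^ f         ≡⟨ f∈F[Y] x x∈Y ⟩
        x             ∎
    b^kf≡a : b ^ (k ∙ f) ≡ a
    b^kf≡a = begin
      b ^ (k ∙ f)   ≡⟨ ^-∙ b k f ⟩
      (b ^ k) ^ f   ≡⟨ cong (_^ f) b^k≡c ⟩
      c ^ f         ≡⟨ c^f≡a ⟩
      a             ∎

  ∃-preimage-⊇ : ∀ {Y₁ Y₂} → StabTransitiveOnCompl A Y₁ → StabTransitiveOnCompl A Y₂ →
                 ∣ Y₂ ∣ ≤ ∣ Y₁ ∣ → ∣ Y₁ ∣ + ∣ Y₂ ∣ < n →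
                 Σ Carrier λ g → Y₂ ⊆ preimage Y₁ g
  ∃-preimage-⊇ {Y₁} {Y₂} transitive₁ transitive₂ ∣Y₂∣≤∣Y₁∣ ∣Y₁∣+∣Y₂∣<n =
    search ε (⊃-wellFounded (Y₂ ∩ preimage Y₁ ε))
    where
    search : ∀ g → Acc _⊃_ (Y₂ ∩ preimage Y₁ g) → Σ Carrier λ g → Y₂ ⊆ preimage Y₁ g
    search g (acc larger) with ⊆-or-∃∉ Y₂ (preimage Y₁ g)
    ... | inj₁ Y₂⊆Z = g , Y₂⊆Z
    ... | inj₂ (b , b∈Y₂ , b∉Z)
      with exchange transitive₂ (StabTransitiveOnCompl-preimage g transitive₁)
             (subst (∣ Y₂ ∣ ≤_) (sym (∣preimage∣ Y₁ g)) ∣Y₂∣≤∣Y₁∣)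
             (subst (λ k → k + ∣ Y₂ ∣ < n) (sym (∣preimage∣ Y₁ g)) ∣Y₁∣+∣Y₂∣<n)
             b∈Y₂ b∉Z
    ... | u , grows =
      search (u ∙ g) (larger (subst (λ Z → Y₂ ∩ preimage Y₁ g ⊂ Y₂ ∩ Z) (sym (preimage-∙ Y₁ u g)) grows))

  ∃-ImageEq : ∀ {Y₁ Y₂} → StabTransitiveOnCompl A Y₁ → StabTransitiveOnCompl A Y₂ →
              ∣ Y₁ ∣ ≡ ∣ Y₂ ∣ → ∣ Y₁ ∣ + ∣ Y₂ ∣ < n →
              Σ Carrier λ g → ImageEq A Y₂ g Y₁
  ∃-ImageEq {Y₁} {Y₂} transitive₁ transitive₂ ∣Y₁∣≡∣Y₂∣ ∣Y₁∣+∣Y₂∣<n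
    with ∃-preimage-⊇ transitive₁ transitive₂ (ℕₚ.≤-reflexive (sym ∣Y₁∣≡∣Y₂∣)) ∣Y₁∣+∣Y₂∣<n
  ... | g , Y₂⊆Z = g , ImageEq-preimage Y₂⊆Z Z⊆Y₂
    where
    Z⊆Y₂ : preimage Y₁ g ⊆ Y₂
    Z⊆Y₂ = p⊆q∧∣q∣≤∣p∣⇒q⊆p Y₂⊆Z (ℕₚ.≤-reflexive (trans (∣preimage∣ Y₁ g) ∣Y₁∣≡∣Y₂∣))

mainTheorem4 : ∀ {c ℓ : Level} (G : Group c ℓ) (n : ℕ) (A : RightAction G n)
               (Y₁ Y₂ : Subset n) →
               ∣ Y₁ ∣ ≡ ∣ Y₂ ∣ →
               2 * ∣ Y₁ ∣ < n →
               StabTransitiveOnCompl A Y₁ →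
               StabTransitiveOnCompl A Y₂ →
               Σ (Group.Carrier G) (λ g →
                 ImageEq A Y₂ g Y₁ ×
                 (∀ h → InStab A Y₂ h ⇔ InStab A Y₁ (Group._∙_ G (Group._∙_ G (Group._⁻¹ G g) h) g)))
mainTheorem4 G n A Y₁ Y₂ ∣Y₁∣≡∣Y₂∣ 2∣Y₁∣<n transitive₁ transitive₂
  with ∃-ImageEq A transitive₁ transitive₂ ∣Y₁∣≡∣Y₂∣
         (subst (λ k → ∣ Y₁ ∣ + k < n) (trans (ℕₚ.+-identityʳ ∣ Y₁ ∣) ∣Y₁∣≡∣Y₂∣) 2∣Y₁∣<n)
... | g , Y₂^g≡Y₁ = g , Y₂^g≡Y₁ , InStab-conj A Y₂^g≡Y₁
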